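{- Let $D$ be a finite or infinite digraph. (1) Let $A$ be a point-basis of $D$. Then $X(D)\setminus A$ contains a point-reaching set of $D$ if and only if $D$ has no sources. (2) Let $A$ be an arc-basis of $D$. Then $X(D)\setminus A$ contains an arc-reaching set of $D$ if and only if every source of $D$ is an isolate.
   Context: $D$ is a digraph with vertex set $X(D)$ (arcs are ordered pairs of distinct vertices), possibly infinite. A source is a vertex of in-degree $0$; an isolate is a vertex of in-degree and out-degree $0$. $v$ is reachable from $u$ if there is a directed path (possibly of length $0$) from $u$ to $v$. A point-reaching set is $S\subseteq X(D)$ such that every vertex is reachable from some vertex of $S$; a point-basis is an inclusion-minimal point-reaching set. An arc-reaching set is $S\subseteq X(D)$ such that for every arc $(u,v)$, $u$ is reachable from some vertex of $S$; an arc-basis is an inclusion-minimal arc-reaching set. -}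

module Defs where

open import Level using (0ℓ)
open import Data.Product using (Σ; ∃; _×_)
open import Relation.Nullary using (¬_)
open import Relation.Unary using (Pred; _∈_; _∉_; _⊆_)
open import Relation.Binary using (Rel)
open import Relation.Binary.Construct.Closure.ReflexiveTransitive using (Star)

record Digraph : Set₁ where
  field
    X     : Set
    Arc   : Rel X 0ℓ
    irrefl : ∀ v → ¬ Arc v v
open Digraph public

module _ (D : Digraph) where

  Reachable : X D → X D → Set
  Reachable = Star (Arc D)

  IsSource : X D → Set
  IsSource v = ¬ (∃ λ u → Arc D u v)

  IsIsolate : X D → Set
  IsIsolate v = ¬ (∃ λ u → Arc D u v) × ¬ (∃ λ w → Arc D v w)

  PointReaching : Pred (X D) 0ℓ → Set
  PointReaching S = ∀ v → ∃ λ s → s ∈ S × Reachable s v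

  ArcReaching : Pred (X D) 0ℓ → Set
  ArcReaching S = ∀ u v → Arc D u v → ∃ λ s → s ∈ S × Reachable s u

  _⊂_ : Pred (X D) 0ℓ → Pred (X D) 0ℓ → Set
  S ⊂ A = S ⊆ A × ¬ (A ⊆ S)

  PointBasis : Pred (X D) 0ℓ → Set₁
  PointBasis A = PointReaching A × (∀ S → S ⊂ A → ¬ PointReaching S)

  ArcBasis : Pred (X D) 0ℓ → Set₁
  ArcBasis A = ArcReaching A × (∀ S → S ⊂ A → ¬ ArcReaching S)

  Compl : Pred (X D) 0ℓ → Pred (X D) 0ℓ
  Compl A v = v ∉ A

-- Work with a predecessor-closed set T of targets and a minimal set A reaching T. No element of A
-- has an in-neighbour w in A: everything it reaches is reached from w, so it could be dropped.
-- Hence if no target is a source, every a ∈ A reaching a target (so itself a target) has an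
-- in-neighbour, necessarily outside A, and X(D) \ A reaches T. Conversely a target that is a
-- source is reached only from itself, so it lies in every reaching set, A included. The two parts
-- take T = all vertices and T = tails of arcs; a tail that is a source is a non-isolated source.
module Submission where

open import Defs
open import Level using (0ℓ)
open import Axiom.ExcludedMiddle using (ExcludedMiddle)
open import Axiom.DoubleNegationElimination using (em⇒dne)
open import Data.Product using (∃; _×_; _,_; proj₁; proj₂)
open import Data.Unit using (tt)
open import Data.Empty using (⊥-elim)
open import Function.Bundles using (_⇔_; mk⇔; Equivalence)
open import Function.Construct.Composition using (_⇔-∘_)
open import Relation.Nullary using (¬_; yes; no)
open import Relation.Unary using (Pred; _∈_; _∉_; _⊆_; U; ∁; _∩_; ｛_｝)
open import Relation.Binary.PropositionalEquality using (_≡_; refl; subst)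
open import Relation.Binary.Construct.Closure.ReflexiveTransitive using (ε; _◅_)

module Reachability (D : Digraph) where

  Reaching : Pred (X D) 0ℓ → Pred (X D) 0ℓ → Set
  Reaching T S = ∀ {t} → t ∈ T → ∃ λ s → s ∈ S × Reachable D s t

  Minimal : (Pred (X D) 0ℓ → Set) → Pred (X D) 0ℓ → Set₁
  Minimal P A = P A × (∀ S → _⊂_ D S A → ¬ P S)

  PredecessorClosed : Pred (X D) 0ℓ → Set
  PredecessorClosed T = ∀ {u t} → Arc D u t → t ∈ T → u ∈ T

  IsTail : Pred (X D) 0ℓ
  IsTail u = ∃ λ v → Arc D u v

  Minimal-cong : ∀ {P Q : Pred (X D) 0ℓ → Set} {A} → (∀ S → P S ⇔ Q S) → Minimal P A → Minimal Q A
  Minimal-cong P⇔Q (PA , minimal) =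
    Equivalence.to (P⇔Q _) PA , λ S S⊂A QS → minimal S S⊂A (Equivalence.from (P⇔Q S) QS)

  reachingOutside-cong : ∀ {P Q : Pred (X D) 0ℓ → Set} A → (∀ S → P S ⇔ Q S) →
    (∃ λ S → S ⊆ Compl D A × P S) ⇔ (∃ λ S → S ⊆ Compl D A × Q S)
  reachingOutside-cong A P⇔Q = mk⇔ (λ (S , S⊆ , PS) → S , S⊆ , Equivalence.to (P⇔Q S) PS)
                                   (λ (S , S⊆ , QS) → S , S⊆ , Equivalence.from (P⇔Q S) QS)

  PointReaching⇔Reaching-U : ∀ S → PointReaching D S ⇔ Reaching U S
  PointReaching⇔Reaching-U S = mk⇔ (λ reach {t} _ → reach t) (λ reach v → reach tt)

  ArcReaching⇔Reaching-IsTail : ∀ S → ArcReaching D S ⇔ Reaching IsTail S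
  ArcReaching⇔Reaching-IsTail S =
    mk⇔ (λ reach {u} (v , uv) → reach u v uv) (λ reach u v uv → reach (v , uv))

  U-predecessorClosed : PredecessorClosed U
  U-predecessorClosed _ _ = tt

  IsTail-predecessorClosed : PredecessorClosed IsTail
  IsTail-predecessorClosed ut _ = _ , ut

  PredecessorClosed-reachable : ∀ {T s t} → PredecessorClosed T → Reachable D s t → t ∈ T → s ∈ T
  PredecessorClosed-reachable closed ε        t∈T = t∈T
  PredecessorClosed-reachable closed (st ◅ p) t∈T = closed st (PredecessorClosed-reachable closed p t∈T)

  reachable-source⇒≡ : ∀ {s t} → IsSource D t → Reachable D s t → s ≡ t
  reachable-source⇒≡ source ε = refl
  reachable-source⇒≡ source (su ◅ p) with reachable-source⇒≡ source p
  ... | refl = ⊥-elim (source (_ , su))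

  target-source∈reaching : ∀ {T S t} → Reaching T S → t ∈ T → IsSource D t → t ∈ S
  target-source∈reaching {S = S} reach t∈T source with reach t∈T
  ... | s , s∈S , p = subst (_∈ S) (reachable-source⇒≡ source p) s∈S

module Bases (em : ExcludedMiddle 0ℓ) (D : Digraph) where

  open Reachability D

  non-source⇒in-arc : ∀ {v} → ¬ IsSource D v → ∃ λ u → Arc D u v
  non-source⇒in-arc = em⇒dne em

  Reaching-remove : ∀ {T A a w} → Reaching T A → w ∈ A → Arc D w a → Reaching T (A ∩ ∁ ｛ a ｝)
  Reaching-remove {a = a} {w} reach w∈A wa t∈T with reach t∈T
  ... | s , s∈A , p with em {a ≡ s}
  ...   | yes refl = w , (w∈A , λ a≡w → irrefl D w (subst (Arc D w) a≡w wa)) , wa ◅ p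
  ...   | no a≢s   = s , (s∈A , a≢s) , p

  Minimal-in-neighbour∉ : ∀ {T A a w} → Minimal (Reaching T) A → a ∈ A → Arc D w a → w ∉ A
  Minimal-in-neighbour∉ {A = A} {a} (reach , minimal) a∈A wa w∈A =
    minimal (A ∩ ∁ ｛ a ｝) (proj₁ , λ A⊆ → proj₂ (A⊆ a∈A) refl) (Reaching-remove reach w∈A wa)

  reachingOutside⇔no-target-source : ∀ {T A} → PredecessorClosed T → Minimal (Reaching T) A →
    (∃ λ S → S ⊆ Compl D A × Reaching T S) ⇔ (∀ t → t ∈ T → ¬ IsSource D t)
  reachingOutside⇔no-target-source {T} {A} closed basis@(reach , _) = mk⇔ no-source outside
    where
    no-source : (∃ λ S → S ⊆ Compl D A × Reaching T S) → ∀ t → t ∈ T → ¬ IsSource D t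
    no-source (S , S⊆ , reachS) t t∈T source =
      S⊆ (target-source∈reaching reachS t∈T source) (target-source∈reaching reach t∈T source)

    outside : (∀ t → t ∈ T → ¬ IsSource D t) → ∃ λ S → S ⊆ Compl D A × Reaching T S
    outside no-target-source = Compl D A , (λ w∉A → w∉A) , reachCompl
      where
      reachCompl : Reaching T (Compl D A)
      reachCompl t∈T with reach t∈T
      ... | a , a∈A , p with non-source⇒in-arc
                               (no-target-source a (PredecessorClosed-reachable closed p t∈T))
      ...   | w , wa = w , Minimal-in-neighbour∉ basis a∈A wa , wa ◅ p

corollary19 : ExcludedMiddle 0ℓ → (D : Digraph) →
    (∀ (A : Pred (X D) 0ℓ) → PointBasis D A →
    ((∃ λ (S : Pred (X D) 0ℓ) → S ⊆ Compl D A × PointReaching D S) ⇔ (∀ v → ¬ IsSource D v)))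
    × (∀ (A : Pred (X D) 0ℓ) → ArcBasis D A →
    ((∃ λ (S : Pred (X D) 0ℓ) → S ⊆ Compl D A × ArcReaching D S) ⇔ (∀ v → IsSource D v → IsIsolate D v)))
corollary19 em D = point , arc
  where
  open Reachability D
  open Bases em D

  point : ∀ A → PointBasis D A →
    (∃ λ S → S ⊆ Compl D A × PointReaching D S) ⇔ (∀ v → ¬ IsSource D v)
  point A basis =
    mk⇔ (λ no-source v → no-source v tt) (λ no-source v _ → no-source v)
    ⇔-∘ (reachingOutside⇔no-target-source U-predecessorClosed
           (Minimal-cong PointReaching⇔Reaching-U basis)
    ⇔-∘ reachingOutside-cong A PointReaching⇔Reaching-U)

  arc : ∀ A → ArcBasis D A →
    (∃ λ S → S ⊆ Compl D A × ArcReaching D S) ⇔ (∀ v → IsSource D v → IsIsolate D v)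
  arc A basis =
    mk⇔ (λ no-tail-source v source → source , λ tail → no-tail-source v tail source)
        (λ sources-isolated t tail source → proj₂ (sources-isolated t source) tail)
    ⇔-∘ (reachingOutside⇔no-target-source IsTail-predecessorClosed
           (Minimal-cong ArcReaching⇔Reaching-IsTail basis)
    ⇔-∘ reachingOutside-cong A ArcReaching⇔Reaching-IsTail)
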